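{- Let $a: M_{2,2,2}(\{ -3,0\},\{ -1,2\})\to\mathbb{Z}_{\ge 0}$ be a function, and assume $(X,i)\in\{(\mathrm{I},1),(\mathrm{I},3),(\mathrm{I},4),(\mathrm{II},1),(\mathrm{II},3),(\mathrm{II},4),(\mathrm{II},6)\}$. If $Q(B(X,i);a)$ is positive semidefinite, then $\sum_{A} a(A)\le 6$.
   Context: For sets of numbers $Z,Y$, $M_{2,2,2}(Z,Y)$ denotes the set of $2\times 4$ real matrices whose first two columns have entries in $Z$ and whose last two columns have entries in $Y$. For a finite set $\mathcal{N}$ of $2\times r$ matrices, a function $a:\mathcal{N}\to\mathbb{Z}_{\ge 0}$ and an $r\times r$ matrix $Q_{11}$, let $Q_{21}$ be the matrix obtained by stacking vertically $a(A)$ copies of each $A\in\mathcal{N}$, let $m=\sum_{A}a(A)$, let $Q_{22}=\begin{bmatrix}6&-3\\-3&6\end{bmatrix}^{\oplus m}$ (block diagonal), and put $Q(Q_{11};a)=\begin{bmatrix}Q_{11}&Q_{21}^\top\\ Q_{21}&Q_{22}\end{bmatrix}$. Define $B^{(\mathrm{I})}_{11}=\begin{bmatrix}4&-2\\-2&4\end{bmatrix}$, $B^{(\mathrm{II})}_{11}=\begin{bmatrix}4&-1\\-1&4\end{bmatrix}$, $B_{22}=\begin{bmatrix}6&-3\\-3&6\end{bmatrix}$, and $B^{(1)}_{21}=\begin{bmatrix}1&1\\1&1\end{bmatrix}$, $B^{(2)}_{21}=\begin{bmatrix}-2&1\\1&1\end{bmatrix}$, $B^{(3)}_{21}=\begin{bmatrix}-2&-2\\1&1\end{bmatrix}$,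 $B^{(4)}_{21}=\begin{bmatrix}-2&1\\-2&1\end{bmatrix}$, $B^{(5)}_{21}=\begin{bmatrix}-2&1\\1&-2\end{bmatrix}$, $B^{(6)}_{21}=\begin{bmatrix}-2&-2\\-2&1\end{bmatrix}$, $B^{(7)}_{21}=\begin{bmatrix}-2&-2\\-2&-2\end{bmatrix}$. For $X\in\{\mathrm{I},\mathrm{II}\}$ and $i\in\{1,\dots,7\}$ set $B(X,i)=\begin{bmatrix}B^{(X)}_{11}&B^{(i)\top}_{21}\\ B^{(i)}_{21}&B_{22}\end{bmatrix}$. -}

module Defs where

open import Data.Nat using (ℕ; zero; suc) renaming (_*_ to _*ℕ_)
open import Data.Fin using (Fin; zero; suc; splitAt; remQuot; _≟_)
open import Data.Integer using (ℤ; +_; -[1+_])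
open import Data.Rational using (ℚ; 0ℚ; _≤_) renaming (_+_ to _+ℚ_; _*_ to _*ℚ_; _/_ to _/ℚ_)
open import Data.Product using (_×_; _,_)
open import Data.Sum using (inj₁; inj₂)
open import Data.List using (List; []; _∷_; length; concatMap; replicate; map; sum; cartesianProductWith)
open import Data.Vec using (Vec; []; _∷_; lookup; fromList)
open import Relation.Nullary using (yes; no)

Mat : ℕ → ℕ → Set
Mat m n = Fin m → Fin n → ℤ

mat2 : ℤ → ℤ → ℤ → ℤ → Mat 2 2
mat2 a b c d zero    zero    = a
mat2 a b c d zero    (suc _) = b
mat2 a b c d (suc _) zero    = c
mat2 a b c d (suc _) (suc _) = d

transpose : ∀ {m n} → Mat m n → Mat n m
transpose A i j = A j i

block : ∀ {p q} → Mat p p → Mat p q → Mat q p → Mat q q → Mat (p Data.Nat.+ q) (p Data.Nat.+ q)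
block {p} A11 A12 A21 A22 i j with splitAt p i | splitAt p j
... | inj₁ i′ | inj₁ j′ = A11 i′ j′
... | inj₁ i′ | inj₂ j′ = A12 i′ j′
... | inj₂ i′ | inj₁ j′ = A21 i′ j′
... | inj₂ i′ | inj₂ j′ = A22 i′ j′

Σℚ : ∀ n → (Fin n → ℚ) → ℚ
Σℚ zero    f = 0ℚ
Σℚ (suc n) f = f zero +ℚ Σℚ n (λ i → f (suc i))

toℚ : ℤ → ℚ
toℚ z = z /ℚ 1

quadForm : ∀ {n} → Mat n n → (Fin n → ℚ) → ℚ
quadForm {n} Q x = Σℚ n (λ i → Σℚ n (λ j → x i *ℚ (toℚ (Q i j) *ℚ x j)))

PositiveSemidefinite : ∀ {n} → Mat n n → Set
PositiveSemidefinite {n} Q = (x : Fin n → ℚ) → 0ℚ ≤ quadForm Q x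

stack : ∀ {m r} → Vec (Mat 2 r) m → Mat (m *ℕ 2) r
stack {m} L i c with remQuot {m} 2 i
... | k , row = lookup L k row c

blockDiag : ∀ m → Mat 2 2 → Mat (m *ℕ 2) (m *ℕ 2)
blockDiag m B i j with remQuot {m} 2 i | remQuot {m} 2 j
... | k , r | l , s with k ≟ l
...   | yes _ = B r s
...   | no  _ = + 0

B22 : Mat 2 2
B22 = mat2 (+ 6) (-[1+ 2 ]) (-[1+ 2 ]) (+ 6)

copies : ∀ {M : Set} {r} → (M → Mat 2 r) → List M → (M → ℕ) → List (Mat 2 r)
copies toMat 𝒩 a = concatMap (λ A → replicate (a A) (toMat A)) 𝒩

-- Q(Q11; a) where 𝒩 is given by an enumeration (list without repetitions)
-- of a finite type M and toMat interprets its elements as 2×r matrices.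
-- Here m = length (copies …), which equals Σ_A a(A).
Qmat : ∀ {M : Set} {r} (toMat : M → Mat 2 r) (𝒩 : List M) (Q11 : Mat r r) (a : M → ℕ) →
       Mat (r Data.Nat.+ length (copies toMat 𝒩 a) *ℕ 2) (r Data.Nat.+ length (copies toMat 𝒩 a) *ℕ 2)
Qmat toMat 𝒩 Q11 a =
  block Q11 (transpose Q21) Q21 (blockDiag (length (copies toMat 𝒩 a)) B22)
  where
  Q21 = stack (fromList (copies toMat 𝒩 a))

data ZE : Set where
  m3 z0 : ZE

data YE : Set where
  m1 p2 : YE

ZEval : ZE → ℤ
ZEval m3 = -[1+ 2 ]
ZEval z0 = + 0

YEval : YE → ℤ
YEval m1 = -[1+ 0 ]
YEval p2 = + 2

-- an element: entries of the first two columns (in Z) and last two columns (in Y)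
record M222 : Set where
  constructor mk
  field
    zpart : Fin 2 → Fin 2 → ZE
    ypart : Fin 2 → Fin 2 → YE

toMat : M222 → Mat 2 4
toMat A i zero                   = ZEval (M222.zpart A i zero)
toMat A i (suc zero)             = ZEval (M222.zpart A i (suc zero))
toMat A i (suc (suc zero))       = YEval (M222.ypart A i zero)
toMat A i (suc (suc (suc zero))) = YEval (M222.ypart A i (suc zero))

arrays : ∀ {E : Set} → E → E → List (Fin 2 → Fin 2 → E)
arrays {E} u v = map (λ (e : Vec E 4) → arr e) (vecs4)
  where
  two : List E
  two = u ∷ v ∷ []
  vecs : ∀ n → List (Vec E n)
  vecs zero    = [] ∷ []
  vecs (suc n) = cartesianProductWith _∷_ two (vecs n)
  vecs4 = vecs 4
  arr : Vec E 4 → Fin 2 → Fin 2 → E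
  arr (e₀ ∷ e₁ ∷ e₂ ∷ e₃ ∷ []) zero    zero    = e₀
  arr (e₀ ∷ e₁ ∷ e₂ ∷ e₃ ∷ []) zero    (suc _) = e₁
  arr (e₀ ∷ e₁ ∷ e₂ ∷ e₃ ∷ []) (suc _) zero    = e₂
  arr (e₀ ∷ e₁ ∷ e₂ ∷ e₃ ∷ []) (suc _) (suc _) = e₃

allM222 : List M222
allM222 = cartesianProductWith mk (arrays m3 z0) (arrays m1 p2)

data Xt : Set where
  I II : Xt

B11 : Xt → Mat 2 2
B11 I  = mat2 (+ 4) (-[1+ 1 ]) (-[1+ 1 ]) (+ 4)
B11 II = mat2 (+ 4) (-[1+ 0 ]) (-[1+ 0 ]) (+ 4)

-- B21^(i), indexed by i ∈ {1,…,7} encoded as Fin 7 (zero ↦ 1, …)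
private
  p1 : ℤ
  p1 = + 1
  n2 : ℤ
  n2 = -[1+ 1 ]

B21 : Fin 7 → Mat 2 2
B21 zero                                         = mat2 p1 p1 p1 p1
B21 (suc zero)                                   = mat2 n2 p1 p1 p1
B21 (suc (suc zero))                             = mat2 n2 n2 p1 p1
B21 (suc (suc (suc zero)))                       = mat2 n2 p1 n2 p1
B21 (suc (suc (suc (suc zero))))                 = mat2 n2 p1 p1 n2
B21 (suc (suc (suc (suc (suc zero)))))           = mat2 n2 n2 n2 p1
B21 (suc (suc (suc (suc (suc (suc zero))))))     = mat2 n2 n2 n2 n2

B : Xt → Fin 7 → Mat 4 4
B X i = block (B11 X) (transpose (B21 i)) (B21 i) B22

data Admissible : Xt → Fin 7 → Set where
  I-1  : Admissible I  zero
  I-3  : Admissible I  (suc (suc zero))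
  I-4  : Admissible I  (suc (suc (suc zero)))
  II-1 : Admissible II zero
  II-3 : Admissible II (suc (suc zero))
  II-4 : Admissible II (suc (suc (suc zero)))
  II-6 : Admissible II (suc (suc (suc (suc (suc zero)))))

-- Schur complement: if Q(B;a) is positive semidefinite, so is its quadratic form at
-- x = (y, z₁, …, z_m) with z_k = −B₂₂⁻¹ A_k y for the blocks A_k of Q₂₁, which gives
--   0 ≤ yᵀ B y − Σ_k (A_k y)ᵀ B₂₂⁻¹ (A_k y) = yᵀ B y − (2/9) Σ_k N(A_k y),
-- N(u) = u₀² + u₀u₁ + u₁² being the norm form of the hexagonal lattice. For each admissible
-- (X,i) there is an integer vector y with N(A y) ≥ 3 for all 256 matrices A of
-- M_{2,2,2}({-3,0},{-1,2}) and yᵀ B(X,i) y < 14/3, so (2/3) m ≤ yᵀ B(X,i) y < 14/3, that is m ≤ 6.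
module Submission where

open import Defs
open import Data.Nat using (ℕ; _≤_)
open import Data.Fin using (Fin)
open import Data.List using (map)
open import Data.Nat.ListAction using (sum)

open import Function using (_∘_)
import Data.Nat as ℕ
open import Data.Nat using (zero; suc; s≤s)
import Data.Nat.Properties as ℕₚ
open import Data.Fin using (zero; suc; _↑ˡ_; _↑ʳ_; quotient; _≟_)
import Data.Fin.Properties as Finₚ
open import Data.Integer as ℤ using (ℤ; 0ℤ; 1ℤ; -[1+_])
open import Data.Rational as ℚ using (ℚ; 0ℚ; _+_; _*_; -_; _<_; _/_)
import Data.Rational.Properties as ℚₚ
open import Data.Rational.Solver using (module +-*-Solver)
open import Data.List using (List; []; _∷_; length; replicate)
import Data.List.Properties as Listₚ
open import Data.List.Relation.Unary.All as All using (All; []; _∷_)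
import Data.List.Relation.Unary.All.Properties as Allₚ
open import Data.Vec using (fromList; lookup; []; _∷_)
open import Data.Vec.Functional using (Vector; _++_)
import Data.Vec.Functional.Properties as Vectorₚ
open import Algebra.Bundles using (CommutativeRing)
open import Algebra.Properties.Semiring.Sum (CommutativeRing.semiring ℚₚ.+-*-commutativeRing)
  using (sum-syntax; sum-cong-≗; sum-replicate-zero; ∑-comm; ∑-distrib-+; *-distribˡ-sum)
open import Algebra.Definitions.RawMonoid ℚ.+-0-rawMonoid using (_×_)
open import Relation.Binary.PropositionalEquality
open import Relation.Nullary using (Dec; yes; no; contradiction)
open import Relation.Nullary.Decidable using (toWitness)

Σℚ≡∑ : ∀ n (f : Vector ℚ n) → Σℚ n f ≡ ∑[ i < n ] f i
Σℚ≡∑ zero    f = refl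
Σℚ≡∑ (suc n) f = cong (f zero +_) (Σℚ≡∑ n (f ∘ suc))

∑-++ : ∀ m {n} (f : Vector ℚ (m ℕ.+ n)) →
       ∑[ k < m ℕ.+ n ] f k ≡ ∑[ i < m ] f (i ↑ˡ n) + ∑[ j < n ] f (m ↑ʳ j)
∑-++ zero        f = sym (ℚₚ.+-identityˡ _)
∑-++ (suc m) {n} f = trans (cong (f zero +_) (∑-++ m (f ∘ suc)))
  (sym (ℚₚ.+-assoc (f zero) (∑[ i < m ] f (suc i ↑ˡ n)) (∑[ j < n ] f (suc m ↑ʳ j))))

bilinear : ∀ {m n} → Mat m n → Vector ℚ m → Vector ℚ n → ℚ
bilinear {m} {n} Q x y = ∑[ i < m ] ∑[ j < n ] (x i * (toℚ (Q i j) * y j))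

quadForm≡bilinear : ∀ {n} (Q : Mat n n) x → quadForm Q x ≡ bilinear Q x x
quadForm≡bilinear {n} Q x =
  trans (Σℚ≡∑ n _) (sum-cong-≗ λ i → Σℚ≡∑ n (λ j → x i * (toℚ (Q i j) * x j)))

bilinear-cong : ∀ {m n} {P Q : Mat m n} {x x′ y y′} →
                (∀ i j → P i j ≡ Q i j) → (∀ i → x i ≡ x′ i) → (∀ j → y j ≡ y′ j) →
                bilinear P x y ≡ bilinear Q x′ y′
bilinear-cong P≡Q x≡x′ y≡y′ = sum-cong-≗ λ i → sum-cong-≗ λ j →
  cong₂ _*_ (x≡x′ i) (cong₂ (λ q t → toℚ q * t) (P≡Q i j) (y≡y′ j))

bilinear-zero : ∀ {m n} (x : Vector ℚ m) (y : Vector ℚ n) → bilinear (λ _ _ → 0ℤ) x y ≡ 0ℚ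
bilinear-zero {m} {n} x y = trans
  (sum-cong-≗ λ i → trans (sum-cong-≗ λ j → trans (cong (x i *_) (ℚₚ.*-zeroˡ (y j))) (ℚₚ.*-zeroʳ (x i)))
                          (sum-replicate-zero n))
  (sum-replicate-zero m)

bilinear-transpose : ∀ {m n} (Q : Mat m n) x y → bilinear (transpose Q) x y ≡ bilinear Q y x
bilinear-transpose Q x y = trans (∑-comm (λ i j → x i * (toℚ (Q j i) * y j)))
  (sum-cong-≗ λ j → sum-cong-≗ λ i → swap-outer (x i) (toℚ (Q j i)) (y j))
  where
  open +-*-Solver
  swap-outer : ∀ a q b → a * (q * b) ≡ b * (q * a)
  swap-outer = solve 3 (λ a q b → a :* (q :* b) := b :* (q :* a)) refl

bilinear-splitˡ : ∀ m {n k} (Q : Mat (m ℕ.+ n) k) x y →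
  bilinear Q x y ≡ bilinear (Q ∘ (_↑ˡ n)) (x ∘ (_↑ˡ n)) y + bilinear (Q ∘ (m ↑ʳ_)) (x ∘ (m ↑ʳ_)) y
bilinear-splitˡ m Q x y = ∑-++ m _

bilinear-splitʳ : ∀ {k} m {n} (Q : Mat k (m ℕ.+ n)) x y →
  bilinear Q x y ≡
  bilinear (λ i j → Q i (j ↑ˡ n)) x (y ∘ (_↑ˡ n)) + bilinear (λ i j → Q i (m ↑ʳ j)) x (y ∘ (m ↑ʳ_))
bilinear-splitʳ m {n} Q x y =
  trans (sum-cong-≗ λ i → ∑-++ m (λ j → x i * (toℚ (Q i j) * y j)))
        (∑-distrib-+ (λ i → ∑[ j < m ] (x i * (toℚ (Q i (j ↑ˡ n)) * y (j ↑ˡ n))))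
                     (λ i → ∑[ j < n ] (x i * (toℚ (Q i (m ↑ʳ j)) * y (m ↑ʳ j)))))

_*ᵥ_ : ∀ {m n} → Mat m n → Vector ℚ n → Vector ℚ m
(Q *ᵥ y) i = ∑[ j < _ ] (toℚ (Q i j) * y j)

bilinear≡∑*ᵥ : ∀ {m n} (Q : Mat m n) x y → bilinear Q x y ≡ ∑[ i < m ] (x i * (Q *ᵥ y) i)
bilinear≡∑*ᵥ Q x y = sum-cong-≗ λ i → sym (*-distribˡ-sum (x i) (λ j → toℚ (Q i j) * y j))

module _ {p q} (A : Mat p p) (B : Mat p q) (C : Mat q p) (D : Mat q q) where

  block-↑ˡ-↑ˡ : ∀ i j → block A B C D (i ↑ˡ q) (j ↑ˡ q) ≡ A i j
  block-↑ˡ-↑ˡ i j rewrite Finₚ.splitAt-↑ˡ p i q | Finₚ.splitAt-↑ˡ p j q = refl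

  block-↑ˡ-↑ʳ : ∀ i j → block A B C D (i ↑ˡ q) (p ↑ʳ j) ≡ B i j
  block-↑ˡ-↑ʳ i j rewrite Finₚ.splitAt-↑ˡ p i q | Finₚ.splitAt-↑ʳ p q j = refl

  block-↑ʳ-↑ˡ : ∀ i j → block A B C D (p ↑ʳ i) (j ↑ˡ q) ≡ C i j
  block-↑ʳ-↑ˡ i j rewrite Finₚ.splitAt-↑ʳ p q i | Finₚ.splitAt-↑ˡ p j q = refl

  block-↑ʳ-↑ʳ : ∀ i j → block A B C D (p ↑ʳ i) (p ↑ʳ j) ≡ D i j
  block-↑ʳ-↑ʳ i j rewrite Finₚ.splitAt-↑ʳ p q i | Finₚ.splitAt-↑ʳ p q j = refl

  bilinear-block : ∀ x w → bilinear (block A B C D) (x ++ w) (x ++ w) ≡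
                           (bilinear A x x + bilinear B x w) + (bilinear C w x + bilinear D w w)
  bilinear-block x w = begin
    bilinear (block A B C D) (x ++ w) (x ++ w)
      ≡⟨ bilinear-splitˡ p (block A B C D) (x ++ w) (x ++ w) ⟩
    bilinear (block A B C D ∘ (_↑ˡ q)) ((x ++ w) ∘ (_↑ˡ q)) (x ++ w) +
    bilinear (block A B C D ∘ (p ↑ʳ_)) ((x ++ w) ∘ (p ↑ʳ_)) (x ++ w)
      ≡⟨ cong₂ _+_ (bilinear-splitʳ p (block A B C D ∘ (_↑ˡ q)) ((x ++ w) ∘ (_↑ˡ q)) (x ++ w))
                   (bilinear-splitʳ p (block A B C D ∘ (p ↑ʳ_)) ((x ++ w) ∘ (p ↑ʳ_)) (x ++ w)) ⟩
    _ ≡⟨ cong₂ _+_ (cong₂ _+_ (bilinear-cong block-↑ˡ-↑ˡ xˡ xˡ) (bilinear-cong block-↑ˡ-↑ʳ xˡ wʳ))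
                   (cong₂ _+_ (bilinear-cong block-↑ʳ-↑ˡ wʳ xˡ) (bilinear-cong block-↑ʳ-↑ʳ wʳ wʳ)) ⟩
    (bilinear A x x + bilinear B x w) + (bilinear C w x + bilinear D w w) ∎
    where
    open ≡-Reasoning
    xˡ : ∀ i → (x ++ w) (i ↑ˡ q) ≡ x i
    xˡ = Vectorₚ.lookup-++ˡ x w
    wʳ : ∀ j → (x ++ w) (p ↑ʳ j) ≡ w j
    wʳ = Vectorₚ.lookup-++ʳ x w

∑ˡ : {A : Set} → (A → ℚ) → List A → ℚ
∑ˡ f []       = 0ℚ
∑ˡ f (x ∷ xs) = f x + ∑ˡ f xs

∑ˡ-distrib-+ : ∀ {A : Set} (f g : A → ℚ) xs → ∑ˡ (λ x → f x + g x) xs ≡ ∑ˡ f xs + ∑ˡ g xs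
∑ˡ-distrib-+ f g []       = sym (ℚₚ.+-identityˡ 0ℚ)
∑ˡ-distrib-+ f g (x ∷ xs) =
  trans (cong (f x + g x +_) (∑ˡ-distrib-+ f g xs)) (interchange (f x) (g x) (∑ˡ f xs) (∑ˡ g xs))
  where
  open +-*-Solver
  interchange : ∀ a b c d → (a + b) + (c + d) ≡ (a + c) + (b + d)
  interchange = solve 4 (λ a b c d → (a :+ b) :+ (c :+ d) := (a :+ c) :+ (b :+ d)) refl

module _ {A : Set} {f : A → ℚ} {c : ℚ} (c≤0 : c ℚ.≤ 0ℚ) where

  ∑ˡ-nonPos : ∀ {xs} → All (λ x → f x ℚ.≤ c) xs → ∑ˡ f xs ℚ.≤ 0ℚ
  ∑ˡ-nonPos []           = ℚₚ.≤-refl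
  ∑ˡ-nonPos (fx≤c ∷ f≤c) = ℚₚ.+-mono-≤ (ℚₚ.≤-trans fx≤c c≤0) (∑ˡ-nonPos f≤c)

  ∑ˡ-≤-× : ∀ k {xs} → All (λ x → f x ℚ.≤ c) xs → k ≤ length xs → ∑ˡ f xs ℚ.≤ k × c
  ∑ˡ-≤-× zero    f≤c          _         = ∑ˡ-nonPos f≤c
  ∑ˡ-≤-× (suc k) (fx≤c ∷ f≤c) (s≤s k≤n) = ℚₚ.+-mono-≤ fx≤c (∑ˡ-≤-× k f≤c k≤n)

stackVectors : ∀ {r} → (Mat 2 r → Vector ℚ 2) → (cs : List (Mat 2 r)) → Vector ℚ (length cs ℕ.* 2)
stackVectors z []       = λ ()
stackVectors z (M ∷ cs) = z M ++ stackVectors z cs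

stack-↑ˡ : ∀ {r} (M : Mat 2 r) cs i j → stack (fromList (M ∷ cs)) (i ↑ˡ length cs ℕ.* 2) j ≡ M i j
stack-↑ˡ M cs zero       j = refl
stack-↑ˡ M cs (suc zero) j = refl

bilinear-stack : ∀ {r} (z : Mat 2 r → Vector ℚ 2) cs y →
  bilinear (stack (fromList cs)) (stackVectors z cs) y ≡ ∑ˡ (λ M → bilinear M (z M) y) cs
bilinear-stack z []       y = refl
bilinear-stack z (M ∷ cs) y =
  trans (bilinear-splitˡ 2 (stack (fromList (M ∷ cs))) (stackVectors z (M ∷ cs)) y)
        (cong₂ _+_ (bilinear-cong (stack-↑ˡ M cs) (Vectorₚ.lookup-++ˡ (z M) (stackVectors z cs)) (λ _ → refl))
                   (bilinear-stack z cs y))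

blockDiag-suc : ∀ m D i j →
  blockDiag (suc m) D i j ≡ block D (λ _ _ → 0ℤ) (λ _ _ → 0ℤ) (blockDiag m D) i j
blockDiag-suc m D zero          zero          = refl
blockDiag-suc m D zero          (suc zero)    = refl
blockDiag-suc m D zero          (suc (suc j)) = refl
blockDiag-suc m D (suc zero)    zero          = refl
blockDiag-suc m D (suc zero)    (suc zero)    = refl
blockDiag-suc m D (suc zero)    (suc (suc j)) = refl
blockDiag-suc m D (suc (suc i)) zero          = refl
blockDiag-suc m D (suc (suc i)) (suc zero)    = refl
blockDiag-suc m D (suc (suc i)) (suc (suc j)) with quotient {m} 2 i ≟ quotient {m} 2 j
... | yes _ = refl
... | no  _ = refl

bilinear-blockDiag : ∀ {r} D (z : Mat 2 r → Vector ℚ 2) cs →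
  bilinear (blockDiag (length cs) D) (stackVectors z cs) (stackVectors z cs) ≡
  ∑ˡ (λ M → bilinear D (z M) (z M)) cs
bilinear-blockDiag D z []       = refl
bilinear-blockDiag D z (M ∷ cs) = begin
  bilinear (blockDiag (suc (length cs)) D) (z M ++ w) (z M ++ w)
    ≡⟨ bilinear-cong {x = z M ++ w} {y = z M ++ w} (blockDiag-suc (length cs) D) (λ _ → refl) (λ _ → refl) ⟩
  bilinear (block D 𝟎 𝟎 (blockDiag (length cs) D)) (z M ++ w) (z M ++ w)
    ≡⟨ bilinear-block D 𝟎 𝟎 (blockDiag (length cs) D) (z M) w ⟩
  (bilinear D (z M) (z M) + bilinear 𝟎 (z M) w) + (bilinear 𝟎 w (z M) + bilinear (blockDiag (length cs) D) w w)
    ≡⟨ cong₂ _+_ (cong (bilinear D (z M) (z M) +_) (bilinear-zero (z M) w))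
                 (cong₂ _+_ (bilinear-zero w (z M)) (bilinear-blockDiag D z cs)) ⟩
  (bilinear D (z M) (z M) + 0ℚ) + (0ℚ + ∑ˡ diagonal cs)
    ≡⟨ cong₂ _+_ (ℚₚ.+-identityʳ (bilinear D (z M) (z M))) (ℚₚ.+-identityˡ (∑ˡ diagonal cs)) ⟩
  bilinear D (z M) (z M) + ∑ˡ diagonal cs ∎
  where
  open ≡-Reasoning
  w = stackVectors z cs
  diagonal : Mat 2 _ → ℚ
  diagonal M = bilinear D (z M) (z M)
  𝟎 : ∀ {m n} → Mat m n
  𝟎 _ _ = 0ℤ

-- Q(Q₁₁; a) is definitionally arrowhead Q₁₁ B22 (copies toMat 𝒩 a).
arrowhead : ∀ {r} → Mat r r → Mat 2 2 → (cs : List (Mat 2 r)) →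
            Mat (r ℕ.+ length cs ℕ.* 2) (r ℕ.+ length cs ℕ.* 2)
arrowhead Q₁₁ D cs = block Q₁₁ (transpose (stack (fromList cs))) (stack (fromList cs)) (blockDiag (length cs) D)

bilinear-arrowhead : ∀ {r} (Q₁₁ : Mat r r) D (z : Mat 2 r → Vector ℚ 2) cs y →
  bilinear (arrowhead Q₁₁ D cs) (y ++ stackVectors z cs) (y ++ stackVectors z cs) ≡
  bilinear Q₁₁ y y + ∑ˡ (λ M → (bilinear M (z M) y + bilinear M (z M) y) + bilinear D (z M) (z M)) cs
bilinear-arrowhead Q₁₁ D z cs y = begin
  bilinear (arrowhead Q₁₁ D cs) (y ++ w) (y ++ w)
    ≡⟨ bilinear-block Q₁₁ (transpose S) S (blockDiag (length cs) D) y w ⟩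
  (bilinear Q₁₁ y y + bilinear (transpose S) y w) + (bilinear S w y + bilinear (blockDiag (length cs) D) w w)
    ≡⟨ cong (λ t → (bilinear Q₁₁ y y + t) + (bilinear S w y + bilinear (blockDiag (length cs) D) w w))
            (bilinear-transpose S y w) ⟩
  (bilinear Q₁₁ y y + bilinear S w y) + (bilinear S w y + bilinear (blockDiag (length cs) D) w w)
    ≡⟨ cong₂ (λ s t → (bilinear Q₁₁ y y + s) + (s + t)) (bilinear-stack z cs y) (bilinear-blockDiag D z cs) ⟩
  (bilinear Q₁₁ y y + ∑ˡ cross cs) + (∑ˡ cross cs + ∑ˡ diagonal cs)
    ≡⟨ regroup (bilinear Q₁₁ y y) (∑ˡ cross cs) (∑ˡ diagonal cs) ⟩
  bilinear Q₁₁ y y + ((∑ˡ cross cs + ∑ˡ cross cs) + ∑ˡ diagonal cs)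
    ≡⟨ cong (bilinear Q₁₁ y y +_) (sym (trans (∑ˡ-distrib-+ (λ M → cross M + cross M) diagonal cs)
                                              (cong (_+ ∑ˡ diagonal cs) (∑ˡ-distrib-+ cross cross cs)))) ⟩
  bilinear Q₁₁ y y + ∑ˡ (λ M → (cross M + cross M) + diagonal M) cs ∎
  where
  open ≡-Reasoning
  open +-*-Solver
  S = stack (fromList cs)
  w = stackVectors z cs
  cross diagonal : Mat 2 _ → ℚ
  cross M = bilinear M (z M) y
  diagonal M = bilinear D (z M) (z M)
  regroup : ∀ q s t → (q + s) + (s + t) ≡ q + ((s + s) + t)
  regroup = solve 3 (λ q s t → (q :+ s) :+ (s :+ t) := q :+ ((s :+ s) :+ t)) refl

hexNorm : Vector ℚ 2 → ℚ
hexNorm u = u zero * u zero + u zero * u (suc zero) + u (suc zero) * u (suc zero)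

-- −B₂₂⁻¹ u, where B₂₂⁻¹ = (1/9) [[2,1],[1,2]].
schurVector : Vector ℚ 2 → Vector ℚ 2
schurVector u zero       = - (ℤ.+ 1 / 9 * (u zero + u zero + u (suc zero)))
schurVector u (suc zero) = - (ℤ.+ 1 / 9 * (u zero + u (suc zero) + u (suc zero)))

schur-minimum : ∀ u → let z = schurVector u in
  (∑[ i < 2 ] (z i * u i) + ∑[ i < 2 ] (z i * u i)) + bilinear B22 z z ≡ - (ℤ.+ 2 / 9) * hexNorm u
schur-minimum u = solve 2 (λ a b →
    let z₀ = :- (con (ℤ.+ 1 / 9) :* ((a :+ a) :+ b))
        z₁ = :- (con (ℤ.+ 1 / 9) :* ((a :+ b) :+ b))
        dot = z₀ :* a :+ (z₁ :* b :+ con 0ℚ)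
        form = (z₀ :* (b₂₂ zero zero :* z₀) :+ (z₀ :* (b₂₂ zero (suc zero) :* z₁) :+ con 0ℚ))
            :+ ((z₁ :* (b₂₂ (suc zero) zero :* z₀) :+ (z₁ :* (b₂₂ (suc zero) (suc zero) :* z₁) :+ con 0ℚ))
            :+ con 0ℚ)
    in (dot :+ dot) :+ form := con (- (ℤ.+ 2 / 9)) :* ((a :* a :+ a :* b) :+ b :* b))
  refl (u zero) (u (suc zero))
  where
  open +-*-Solver
  b₂₂ : Fin 2 → Fin 2 → Polynomial 2
  b₂₂ i j = con (toℚ (B22 i j))

schur-block-≤ : ∀ {r} (M : Mat 2 r) y → ℤ.+ 3 / 1 ℚ.≤ hexNorm (M *ᵥ y) →
  let z = schurVector (M *ᵥ y) in (bilinear M z y + bilinear M z y) + bilinear B22 z z ℚ.≤ - (ℤ.+ 2 / 3)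
schur-block-≤ M y 3≤N = begin
  (bilinear M z y + bilinear M z y) + bilinear B22 z z
    ≡⟨ cong (λ t → (t + t) + bilinear B22 z z) (bilinear≡∑*ᵥ M z y) ⟩
  (∑[ i < 2 ] (z i * u i) + ∑[ i < 2 ] (z i * u i)) + bilinear B22 z z
    ≡⟨ schur-minimum u ⟩
  - (ℤ.+ 2 / 9) * hexNorm u
    ≤⟨ ℚₚ.*-monoˡ-≤-nonPos (- (ℤ.+ 2 / 9)) 3≤N ⟩
  - (ℤ.+ 2 / 3) ∎
  where
  open ℚₚ.≤-Reasoning
  u = M *ᵥ y
  z = schurVector u

module _ {M : Set} {r} (toMat : M → Mat 2 r) (a : M → ℕ) where

  length-copies : ∀ 𝒩 → length (copies toMat 𝒩 a) ≡ sum (map a 𝒩)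
  length-copies []      = refl
  length-copies (A ∷ 𝒩) = trans (Listₚ.length-++ (replicate (a A) (toMat A)))
                                (cong₂ ℕ._+_ (Listₚ.length-replicate (a A)) (length-copies 𝒩))

  All-copies : ∀ {P : Mat 2 r → Set} {𝒩} → All (P ∘ toMat) 𝒩 → All P (copies toMat 𝒩 a)
  All-copies []       = []
  All-copies (p ∷ ps) = Allₚ.++⁺ (Allₚ.replicate⁺ _ p) (All-copies ps)

psd-size-bound : ∀ {M : Set} {r} (toMat : M → Mat 2 r) 𝒩 (Q₁₁ : Mat r r) a n (y : Vector ℚ r) →
  All (λ A → ℤ.+ 3 / 1 ℚ.≤ hexNorm (toMat A *ᵥ y)) 𝒩 →
  bilinear Q₁₁ y y + suc n × - (ℤ.+ 2 / 3) < 0ℚ →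
  PositiveSemidefinite (Qmat toMat 𝒩 Q₁₁ a) → sum (map a 𝒩) ≤ n
psd-size-bound toMat 𝒩 Q₁₁ a n y norms negative psd with sum (map a 𝒩) ℕ.≤? n
... | yes m≤n = m≤n
... | no  m≰n = contradiction 0<0 (ℚₚ.<-irrefl refl)
  where
  open ℚₚ.≤-Reasoning
  cs = copies toMat 𝒩 a
  z : Mat 2 _ → Vector ℚ 2
  z M = schurVector (M *ᵥ y)
  x = y ++ stackVectors z cs
  term : Mat 2 _ → ℚ
  term M = (bilinear M (z M) y + bilinear M (z M) y) + bilinear B22 (z M) (z M)
  many-blocks : suc n ≤ length cs
  many-blocks = subst (suc n ≤_) (sym (length-copies toMat a 𝒩)) (ℕₚ.≰⇒> m≰n)
  terms≤ : ∑ˡ term cs ℚ.≤ suc n × - (ℤ.+ 2 / 3)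
  terms≤ = ∑ˡ-≤-× (ℚₚ.nonPositive⁻¹ (- (ℤ.+ 2 / 3))) (suc n)
             (All-copies toMat a (All.map (λ {A} → schur-block-≤ (toMat A) y) norms)) many-blocks
  0<0 : 0ℚ < 0ℚ
  0<0 = begin-strict
    0ℚ                                       ≤⟨ psd x ⟩
    quadForm (arrowhead Q₁₁ B22 cs) x        ≡⟨ quadForm≡bilinear (arrowhead Q₁₁ B22 cs) x ⟩
    bilinear (arrowhead Q₁₁ B22 cs) x x      ≡⟨ bilinear-arrowhead Q₁₁ B22 z cs y ⟩
    bilinear Q₁₁ y y + ∑ˡ term cs            ≤⟨ ℚₚ.+-monoʳ-≤ (bilinear Q₁₁ y y) terms≤ ⟩
    bilinear Q₁₁ y y + suc n × - (ℤ.+ 2 / 3) <⟨ negative ⟩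
    0ℚ                                       ∎

HexNormsAtLeast3 : Vector ℚ 4 → Set
HexNormsAtLeast3 y = All (λ A → ℤ.+ 3 / 1 ℚ.≤ hexNorm (toMat A *ᵥ y)) allM222

hexNorms? : ∀ y → Dec (HexNormsAtLeast3 y)
hexNorms? y = All.all? (λ A → ℤ.+ 3 / 1 ℚₚ.≤? hexNorm (toMat A *ᵥ y)) allM222

intVector : ℤ → ℤ → ℤ → ℤ → Vector ℚ 4
intVector a b c d = toℚ ∘ lookup (a ∷ b ∷ c ∷ d ∷ [])

-1ℤ : ℤ
-1ℤ = -[1+ 0 ]

y₁ y₃ y₄ y₆ : Vector ℚ 4
y₁ = intVector -1ℤ -1ℤ 1ℤ  1ℤ
y₃ = intVector -1ℤ -1ℤ -1ℤ 0ℤ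
y₄ = intVector -1ℤ 0ℤ  -1ℤ -1ℤ
y₆ = intVector -1ℤ -1ℤ -1ℤ -1ℤ

hexNorms-y₁ : HexNormsAtLeast3 y₁
hexNorms-y₁ = toWitness {a? = hexNorms? y₁} _

hexNorms-y₃ : HexNormsAtLeast3 y₃
hexNorms-y₃ = toWitness {a? = hexNorms? y₃} _

hexNorms-y₄ : HexNormsAtLeast3 y₄
hexNorms-y₄ = toWitness {a? = hexNorms? y₄} _

hexNorms-y₆ : HexNormsAtLeast3 y₆
hexNorms-y₆ = toWitness {a? = hexNorms? y₆} _

certificate : ∀ {X i} → Admissible X i → Vector ℚ 4
certificate I-1  = y₁
certificate I-3  = y₃
certificate I-4  = y₄
certificate II-1 = y₁
certificate II-3 = y₃
certificate II-4 = y₄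
certificate II-6 = y₆

certificate-hexNorms : ∀ {X i} (adm : Admissible X i) → HexNormsAtLeast3 (certificate adm)
certificate-hexNorms I-1  = hexNorms-y₁
certificate-hexNorms I-3  = hexNorms-y₃
certificate-hexNorms I-4  = hexNorms-y₄
certificate-hexNorms II-1 = hexNorms-y₁
certificate-hexNorms II-3 = hexNorms-y₃
certificate-hexNorms II-4 = hexNorms-y₄
certificate-hexNorms II-6 = hexNorms-y₆

certificate-small : ∀ {X i} (adm : Admissible X i) →
  let y = certificate adm in bilinear (B X i) y y + 7 × - (ℤ.+ 2 / 3) < 0ℚ
certificate-small I-1  = ℚₚ.negative⁻¹ _
certificate-small I-3  = ℚₚ.negative⁻¹ _
certificate-small I-4  = ℚₚ.negative⁻¹ _
certificate-small II-1 = ℚₚ.negative⁻¹ _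
certificate-small II-3 = ℚₚ.negative⁻¹ _
certificate-small II-4 = ℚₚ.negative⁻¹ _
certificate-small II-6 = ℚₚ.negative⁻¹ _

lemma4p6 : (a : M222 → ℕ) (X : Xt) (i : Fin 7) → Admissible X i →
    PositiveSemidefinite (Qmat toMat allM222 (B X i) a) →
    sum (map a allM222) ≤ 6
lemma4p6 a X i adm = psd-size-bound toMat allM222 (B X i) a 6 (certificate adm)
  (certificate-hexNorms adm) (certificate-small adm)
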